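{- Let $e$ be a positive cube-free integer with $e\neq1$, let $E:\ y^2=x^3+e^2$, and let $\alpha_-:E(\mathbb{Q})\to\mathbb{Q}^*/\mathbb{Q}^{*3}$ be defined by $\alpha_-(x,y)=y-e$ for $y\ne e$, $y\neq\infty$, $\alpha_-(P_\infty)=1$, $\alpha_-(0,e)=\frac1{2e}$. Then for every rational point $P$ of $E$, the class $\alpha_-(P)$ is represented by an integer $s=A\cdot B^2$, where $A$ and $B$ are coprime square-free positive integers that divide $2e$.
   Context: $\mathbb{Q}^*/\mathbb{Q}^{*3}$ is the group of nonzero rationals modulo nonzero cubes; $P_\infty$ is the point at infinity of $E$. -}

module Defs where

open import Data.Nat as ℕ using (ℕ; zero; suc)
open import Data.Nat.Divisibility using (_∣_)
open import Data.Integer as ℤ using (ℤ; +_)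
open import Data.Rational using (ℚ; _/_; _-_; _+_; _*_; 0ℚ; 1ℚ)
open import Data.Rational.Properties using (_≟_)
open import Data.Product using (Σ; _×_)
open import Relation.Nullary using (¬_; yes; no)
open import Relation.Binary.PropositionalEquality using (_≡_; _≢_)

CubeFree : ℕ → Set
CubeFree n = ∀ (p : ℕ) → p ℕ.* p ℕ.* p ∣ n → p ≡ 1

SquareFree : ℕ → Set
SquareFree n = ∀ (p : ℕ) → p ℕ.* p ∣ n → p ≡ 1

ℕ→ℚ : ℕ → ℚ
ℕ→ℚ n = (+ n) / 1

data Point (e : ℕ) : Set where
  P∞  : Point e
  aff : (x y : ℚ) → y * y ≡ x * x * x + ℕ→ℚ e * ℕ→ℚ e → Point e

-- 1/(2e)  (for e = 0 an irrelevant junk value; the theorem assumes e ≥ 2)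
inv2e : ℕ → ℚ
inv2e zero    = 0ℚ
inv2e (suc k) = (+ 1) / (2 ℕ.* suc k)

-- representative in ℚ* of α₋(P) ∈ ℚ*/ℚ*³
α₋ : (e : ℕ) → Point e → ℚ
α₋ e P∞ = 1ℚ
α₋ e (aff x y _) with y ≟ ℕ→ℚ e
... | yes _ = inv2e e
... | no  _ = y - ℕ→ℚ e

CubeClassEq : ℚ → ℚ → Set
CubeClassEq q r = Σ ℚ (λ c → (c ≢ 0ℚ) × (q ≡ r * (c * c * c)))

-- Write an affine point as y = n/d, x = r/t in lowest terms.  Clearing
-- denominators in the curve equation and using coprimality gives d² = t³,
-- and then (n - ed)(n + ed) = r³.  A prime outside 2e cannot divide both
-- factors (it would divide 2ed, hence d and n), so the prime-by-prime
-- argument of `decompose` writes |n - ed| = A·B²·W³ with A, B coprime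
-- square-free divisors of 2e.  As d² = t³, y - e = (n - ed)/d equals
-- A·B²·(±W·t/d)³.  The point (0, e) is the same computation for
-- 1/(2e) = M²/M³ with M = 2e, since M²·M is a cube; α₋(P∞) = 1 is trivial.
module Submission where

open import Defs
open import Data.Nat using (ℕ; zero; suc; pred; _*_; _≤_; _<_; s≤s; z≤n; NonZero; >-nonZero; nonTrivial⇒n>1)
import Data.Nat.Properties as ℕP
open import Data.Nat.Divisibility
open import Data.Nat.Coprimality using (Coprime; coprime-divisor; recompute; 1-coprimeTo) renaming (sym to coprime-sym)
open import Data.Nat.Primality using (Prime; euclidsLemma; prime⇒irreducible; prime⇒nonZero; prime⇒nonTrivial; ¬prime[1])
open import Data.Nat.Primality.Factorisation using (factorise)
open import Data.Nat.ListAction using (product)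
open import Data.Nat.Induction using (<-wellFounded)
open import Induction.WellFounded using (Acc; acc)
open import Data.List using ([]; _∷_)
open import Data.List.Relation.Unary.All using (_∷_)
open import Data.Product using (Σ; ∃-syntax; _×_; _,_; proj₁; proj₂)
open import Data.Sum using (inj₁; inj₂)
open import Data.Empty using (⊥-elim)
open import Relation.Nullary using (¬_; yes; no)
open import Relation.Binary.PropositionalEquality
open import Data.Nat.Tactic.RingSolver using (solve-∀)
open import Data.Integer as ℤ using (ℤ; +_; -[1+_]; 0ℤ)
import Data.Integer.Properties as ℤP
import Data.Integer.Divisibility.Signed as ℤ∣
open import Data.Integer.Tactic.RingSolver using () renaming (solve-∀ to ℤ-solve)
open import Data.Rational as ℚ using (ℚ; mkℚ; toℚᵘ; fromℚᵘ)
import Data.Rational.Properties as ℚP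
open import Data.Rational.Unnormalised as ℚᵘ using (ℚᵘ; mkℚᵘ; _≃_; *≡*)
import Data.Rational.Unnormalised.Properties as ℚᵘP

cube : ℕ → ℕ
cube m = m * m * m

cube-* : ∀ a b → cube (a * b) ≡ cube a * cube b
cube-* = expanded
  where
  expanded : ∀ a b → a * b * (a * b) * (a * b) ≡ a * a * a * (b * b * b)
  expanded = solve-∀

prime-∤⇒coprime : ∀ {p w} → Prime p → ¬ p ∣ w → Coprime p w
prime-∤⇒coprime pr p∤w (d∣p , d∣w) with prime⇒irreducible pr d∣p
... | inj₁ d≡1 = d≡1
... | inj₂ refl = ⊥-elim (p∤w d∣w)

coprime-*ˡ : ∀ {a b c} → Coprime a c → Coprime b c → Coprime (a * b) c
coprime-*ˡ {a} {b} {c} a⊥c b⊥c {d} (d∣ab , d∣c) = b⊥c (coprime-divisor d⊥a d∣ab , d∣c)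
  where
  d⊥a : Coprime d a
  d⊥a (k∣d , k∣a) = a⊥c (k∣a , ∣-trans k∣d d∣c)

coprime-*-∣ : ∀ {a b M} → Coprime a b → a ∣ M → b ∣ M → a * b ∣ M
coprime-*-∣ {a} {b} a⊥b a∣M (divides k M≡kb)
  with coprime-divisor a⊥b (subst (a ∣_) (trans M≡kb (ℕP.*-comm k b)) a∣M)
... | divides j refl = divides j (trans M≡kb (ℕP.*-assoc j a b))

prime∣cube⇒∣ : ∀ {p m} → Prime p → p ∣ cube m → p ∣ m
prime∣cube⇒∣ {m = m} pr p∣m³ with euclidsLemma (m * m) m pr p∣m³
... | inj₂ p∣m = p∣m
... | inj₁ p∣m² with euclidsLemma m m pr p∣m²
...   | inj₁ p∣m = p∣m
...   | inj₂ p∣m = p∣m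

prime-factor : ∀ u → 2 ≤ u → ∃[ p ] Prime p × p ∣ u
prime-factor (suc zero) (s≤s ())
prime-factor u@(suc (suc _)) _ with factorise u
... | record { factors = [] ; isFactorisation = () }
... | record { factors = p ∷ ps ; isFactorisation = u≡ ; factorsPrime = pr ∷ _ } =
  p , pr , divides (product ps) (trans u≡ (ℕP.*-comm p (product ps)))

squareFree-1 : SquareFree 1
squareFree-1 q q²∣1 = ℕP.m*n≡1⇒n≡1 q q (∣1⇒≡1 q²∣1)

squareFree-∣ : ∀ {A D} → SquareFree A → D ∣ A → SquareFree D
squareFree-∣ sfA D∣A q q²∣D = sfA q (∣-trans q²∣D D∣A)

squareFree-prime* : ∀ {p A} → Prime p → ¬ p ∣ A → SquareFree A → SquareFree (p * A)
squareFree-prime* {p} {A} pr p∤A sfA q q²∣pA with p ∣? q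
... | yes (divides r refl) =
  ⊥-elim (p∤A (*-cancelˡ-∣ p {{prime⇒nonZero pr}} (∣-trans (divides (r * r) (square r p)) q²∣pA)))
  where
  square : ∀ r p → r * p * (r * p) ≡ r * r * (p * p)
  square = solve-∀
... | no p∤q = sfA q (coprime-divisor (coprime-*ˡ q⊥p q⊥p) q²∣pA)
  where
  q⊥p : Coprime q p
  q⊥p = coprime-sym (prime-∤⇒coprime pr p∤q)

prime>1 : ∀ {p} → Prime p → 1 < p
prime>1 {p} pr = nonTrivial⇒n>1 p {{prime⇒nonTrivial pr}}

cube>1 : ∀ {p} → 1 < p → 1 < cube p
cube>1 {suc zero} (s≤s ())
cube>1 {suc (suc _)} _ = s≤s (s≤s z≤n)

factor-< : ∀ {u₀ v k} → suc u₀ ≡ v * k → 1 < k → v < suc u₀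
factor-< {v = v@(suc _)} {k} u≡vk 1<k = subst (v <_) (sym u≡vk) (ℕP.m<m*n v k 1<k)

record Decomposition (M u : ℕ) : Set where
  constructor decomposition
  field
    A B W         : ℕ
    squareFreeA   : SquareFree A
    squareFreeB   : SquareFree B
    coprimeAB     : Coprime A B
    A∣M           : A ∣ M
    B∣M           : B ∣ M
    factorisation : u ≡ A * (B * B) * cube W

decomposition-cube : ∀ {M} W → Decomposition M (cube W)
decomposition-cube W =
  decomposition 1 1 W squareFree-1 squareFree-1 (1-coprimeTo 1) (1∣ _) (1∣ _)
    (sym (ℕP.*-identityˡ (cube W)))

decomposition-*cube : ∀ {M u} q → Decomposition M u → Decomposition M (u * cube q)
decomposition-*cube {u = u} q (decomposition A B W sfA sfB A⊥B A∣M B∣M u≡) =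
  decomposition A B (W * q) sfA sfB A⊥B A∣M B∣M (begin
    u * cube q                      ≡⟨ cong (_* cube q) u≡ ⟩
    A * (B * B) * cube W * cube q   ≡⟨ ℕP.*-assoc (A * (B * B)) (cube W) (cube q) ⟩
    A * (B * B) * (cube W * cube q) ≡⟨ cong (A * (B * B) *_) (sym (cube-* W q)) ⟩
    A * (B * B) * cube (W * q)      ∎)
  where open ≡-Reasoning

-- Multiplying by a prime p dividing M: if p ∣ A it moves from A into B,
-- if p ∣ B it completes the cube p³ and moves into W, otherwise it joins A.
decomposition-*prime : ∀ {M u p} → Prime p → p ∣ M → Decomposition M u → Decomposition M (u * p)
decomposition-*prime {p = p} pr p∣M (decomposition A B W sfA sfB A⊥B A∣M B∣M refl) with p ∣? A | p ∣? B
... | yes (divides A₁ refl) | _ =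
  decomposition A₁ (p * B) W (squareFree-∣ sfA (m∣m*n p)) (squareFree-prime* pr p∤B sfB) A₁⊥pB
    (∣-trans (m∣m*n p) A∣M) (coprime-*-∣ (prime-∤⇒coprime pr p∤B) p∣M B∣M) (move A₁ p B W)
  where
  p∤B : ¬ p ∣ B
  p∤B p∣B = ¬prime[1] (subst Prime (A⊥B (n∣m*n A₁ , p∣B)) pr)
  p⊥A₁ : Coprime p A₁
  p⊥A₁ = prime-∤⇒coprime pr (λ p∣A₁ → ¬prime[1] (subst Prime (sfA p (*-monoˡ-∣ p p∣A₁)) pr))
  A₁⊥pB : Coprime A₁ (p * B)
  A₁⊥pB = coprime-sym (coprime-*ˡ p⊥A₁ B⊥A₁)
    where
    B⊥A₁ : Coprime B A₁
    B⊥A₁ (d∣B , d∣A₁) = A⊥B (∣-trans d∣A₁ (m∣m*n p) , d∣B)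
  move : ∀ a p b w → a * p * (b * b) * (w * w * w) * p ≡ a * (p * b * (p * b)) * (w * w * w)
  move = solve-∀
... | no _ | yes (divides B₁ refl) =
  decomposition A B₁ (W * p) sfA (squareFree-∣ sfB (m∣m*n p)) (λ (d∣A , d∣B₁) → A⊥B (d∣A , ∣-trans d∣B₁ (m∣m*n p)))
    A∣M (∣-trans (m∣m*n p) B∣M) (move A B₁ p W)
  where
  move : ∀ a b p w → a * (b * p * (b * p)) * (w * w * w) * p ≡ a * (b * b) * (w * p * (w * p) * (w * p))
  move = solve-∀
... | no p∤A | no p∤B =
  decomposition (p * A) B W (squareFree-prime* pr p∤A sfA) sfB (coprime-*ˡ (prime-∤⇒coprime pr p∤B) A⊥B)
    (coprime-*-∣ (prime-∤⇒coprime pr p∤A) p∣M A∣M) B∣M (move A B p W)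
  where
  move : ∀ a b p w → a * (b * b) * (w * w * w) * p ≡ p * a * (b * b) * (w * w * w)
  move = solve-∀

peel-prime-cube : ∀ {p u w m} → Prime p → p ∣ u → ¬ p ∣ w → u * w ≡ cube m →
  ∃[ v ] ∃[ m′ ] u ≡ v * cube p × v * w ≡ cube m′
peel-prime-cube {p} {u} {w} {m} pr p∣u p∤w uw≡m³
  with prime∣cube⇒∣ {m = m} pr (subst (p ∣_) uw≡m³ (∣m⇒∣m*n w p∣u))
... | divides m′ refl with coprime-divisor p³⊥w (divides (cube m′) wu≡)
  where
  p⊥w : Coprime p w
  p⊥w = prime-∤⇒coprime pr p∤w
  p³⊥w : Coprime (cube p) w
  p³⊥w = coprime-*ˡ (coprime-*ˡ p⊥w p⊥w) p⊥w
  wu≡ : w * u ≡ cube m′ * cube p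
  wu≡ = trans (ℕP.*-comm w u) (trans uw≡m³ (cube-* m′ p))
... | divides v u≡ = v , m′ , u≡ , ℕP.*-cancelʳ-≡ (v * w) (cube m′) (cube p) {{p³≢0}} (begin
    v * w * cube p ≡⟨ swap v w (cube p) ⟩
    v * cube p * w ≡⟨ cong (_* w) (sym u≡) ⟩
    u * w          ≡⟨ uw≡m³ ⟩
    cube (m′ * p)  ≡⟨ cube-* m′ p ⟩
    cube m′ * cube p ∎)
  where
  open ≡-Reasoning
  p³≢0 : NonZero (cube p)
  p³≢0 = >-nonZero (ℕP.<-trans (s≤s z≤n) (cube>1 (prime>1 pr)))
  swap : ∀ a b c → a * b * c ≡ a * c * b
  swap = solve-∀

Separated : ℕ → ℕ → ℕ → Set
Separated M u w = ∀ p → Prime p → ¬ p ∣ M → p ∣ u → ¬ p ∣ w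

-- Strong
-- induction on u, removing one prime factor p of u at a time: if p ∣ M it is
-- absorbed into the decomposition, otherwise p ∤ w forces p³ ∣ u.
decompose : ∀ {M} u w m → u * w ≡ cube m → Separated M u w → Decomposition M u
decompose {M} u w m = go u w m (<-wellFounded u)
  where
  go : ∀ u w m → Acc _<_ u → u * w ≡ cube m → Separated M u w → Decomposition M u
  go zero          _ _ _ _ _ = decomposition-cube 0
  go (suc zero)    _ _ _ _ _ = decomposition-cube 1
  go u@(suc (suc _)) w m (acc rec) uw≡m³ sep with prime-factor u (s≤s (s≤s z≤n))
  ... | p , pr , p∣u@(divides u′ u≡u′p) with p ∣? M
  ...   | yes p∣M = subst (Decomposition M) (sym u≡u′p)
            (decomposition-*prime pr p∣M (go u′ (p * w) m (rec (factor-< u≡u′p (prime>1 pr))) u′pw≡m³ sep′))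
    where
    u′pw≡m³ : u′ * (p * w) ≡ cube m
    u′pw≡m³ = trans (sym (ℕP.*-assoc u′ p w)) (trans (cong (_* w) (sym u≡u′p)) uw≡m³)
    sep′ : Separated M u′ (p * w)
    sep′ q qr q∤M q∣u′ q∣pw with euclidsLemma p w qr q∣pw
    ... | inj₂ q∣w = sep q qr q∤M (∣-trans q∣u′ (divides p (trans u≡u′p (ℕP.*-comm u′ p)))) q∣w
    ... | inj₁ q∣p with prime⇒irreducible pr q∣p
    ...   | inj₁ refl = ¬prime[1] qr
    ...   | inj₂ refl = q∤M p∣M
  ...   | no p∤M with peel-prime-cube {m = m} pr p∣u (sep p pr p∤M p∣u) uw≡m³
  ...     | v , m′ , u≡vp³ , vw≡m′³ = subst (Decomposition M) (sym u≡vp³)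
            (decomposition-*cube p (go v w m′ (rec (factor-< u≡vp³ (cube>1 (prime>1 pr)))) vw≡m′³ sep′))
    where
    sep′ : Separated M v w
    sep′ q qr q∤M q∣v = sep q qr q∤M (∣-trans q∣v (divides (cube p) (trans u≡vp³ (ℕP.*-comm v (cube p)))))

∣-∣-divides : ∀ {a} b c → a ≡ b ℤ.* c → (ℤ.∣ b ∣) ∣ (ℤ.∣ a ∣)
∣-∣-divides b c refl = divides ℤ.∣ c ∣ (trans (ℤP.abs-* b c) (ℕP.*-comm ℤ.∣ b ∣ ℤ.∣ c ∣))

abs-cube : ∀ r → ℤ.∣ r ℤ.* r ℤ.* r ∣ ≡ cube ℤ.∣ r ∣
abs-cube r = trans (ℤP.abs-* (r ℤ.* r) r) (cong (_* ℤ.∣ r ∣) (ℤP.abs-* r r))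

denominators : ∀ {n d r t} → Coprime n d → Coprime r t →
  d * d ∣ n * n * cube t → cube t ∣ cube r * (d * d) → d * d ≡ cube t
denominators {n} {d} {r} {t} n⊥d r⊥t d²∣n²t³ t³∣r³d² =
  ∣-antisym (coprime-divisor d²⊥n² d²∣n²t³) (coprime-divisor t³⊥r³ t³∣r³d²)
  where
  d⊥n² : Coprime d (n * n)
  d⊥n² = coprime-sym (coprime-*ˡ n⊥d n⊥d)
  d²⊥n² : Coprime (d * d) (n * n)
  d²⊥n² = coprime-*ˡ d⊥n² d⊥n²
  t⊥r³ : Coprime t (cube r)
  t⊥r³ = coprime-sym (coprime-*ˡ (coprime-*ˡ r⊥t r⊥t) r⊥t)
  t³⊥r³ : Coprime (cube t) (cube r)
  t³⊥r³ = coprime-*ˡ (coprime-*ˡ t⊥r³ t⊥r³) t⊥r³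

lowest-terms-point : ∀ (e : ℕ) n dm r tm → Coprime ℤ.∣ n ∣ (suc dm) → Coprime ℤ.∣ r ∣ (suc tm) →
  let D = + suc dm; T³ = + suc tm ℤ.* + suc tm ℤ.* + suc tm in
  n ℤ.* n ℤ.* T³ ≡ D ℤ.* D ℤ.* (r ℤ.* r ℤ.* r ℤ.+ + e ℤ.* + e ℤ.* T³) →
  suc dm * suc dm ≡ cube (suc tm) × (n ℤ.- + e ℤ.* D) ℤ.* (n ℤ.+ + e ℤ.* D) ≡ r ℤ.* r ℤ.* r
lowest-terms-point e n dm r tm n⊥d r⊥t cleared = d²≡t³ , ℤP.*-cancelʳ-≡ _ _ (D ℤ.* D) (begin
    (n ℤ.- + e ℤ.* D) ℤ.* (n ℤ.+ + e ℤ.* D) ℤ.* (D ℤ.* D)     ≡⟨ expand n (+ e) D ⟩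
    n ℤ.* n ℤ.* (D ℤ.* D) ℤ.- D ℤ.* D ℤ.* (+ e ℤ.* + e ℤ.* (D ℤ.* D))
        ≡⟨ cong (λ X → n ℤ.* n ℤ.* X ℤ.- D ℤ.* D ℤ.* (+ e ℤ.* + e ℤ.* X)) (cong +_ d²≡t³) ⟩
    n ℤ.* n ℤ.* T³ ℤ.- D ℤ.* D ℤ.* (+ e ℤ.* + e ℤ.* T³)        ≡⟨ cong (ℤ._- D ℤ.* D ℤ.* (+ e ℤ.* + e ℤ.* T³)) cleared ⟩
    D ℤ.* D ℤ.* (r³ ℤ.+ + e ℤ.* + e ℤ.* T³) ℤ.- D ℤ.* D ℤ.* (+ e ℤ.* + e ℤ.* T³) ≡⟨ cancel (D ℤ.* D) r³ (+ e ℤ.* + e ℤ.* T³) ⟩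
    r³ ℤ.* (D ℤ.* D)                                          ∎)
  where
  open ≡-Reasoning
  D T³ r³ : ℤ
  D = + suc dm
  T³ = + suc tm ℤ.* + suc tm ℤ.* + suc tm
  r³ = r ℤ.* r ℤ.* r
  d²∣n²t³ : suc dm * suc dm ∣ (ℤ.∣ n ∣ * ℤ.∣ n ∣ * cube (suc tm))
  d²∣n²t³ = subst (suc dm * suc dm ∣_) (trans (ℤP.abs-* (n ℤ.* n) T³) (cong (_* cube (suc tm)) (ℤP.abs-* n n)))
              (∣-∣-divides (D ℤ.* D) _ cleared)
  rearranged : ∀ n r e D T³ → n ℤ.* n ℤ.* T³ ≡ D ℤ.* D ℤ.* (r ℤ.+ e ℤ.* T³) →
               r ℤ.* (D ℤ.* D) ≡ T³ ℤ.* (n ℤ.* n ℤ.- e ℤ.* (D ℤ.* D))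
  rearranged n r e D T³ eq = begin
    r ℤ.* (D ℤ.* D)                                       ≡⟨ isolate r e D T³ ⟩
    D ℤ.* D ℤ.* (r ℤ.+ e ℤ.* T³) ℤ.- e ℤ.* (D ℤ.* D) ℤ.* T³ ≡⟨ cong (ℤ._- e ℤ.* (D ℤ.* D) ℤ.* T³) (sym eq) ⟩
    n ℤ.* n ℤ.* T³ ℤ.- e ℤ.* (D ℤ.* D) ℤ.* T³             ≡⟨ factor n e D T³ ⟩
    T³ ℤ.* (n ℤ.* n ℤ.- e ℤ.* (D ℤ.* D))                  ∎
    where
    isolate : ∀ r e D T³ → r ℤ.* (D ℤ.* D) ≡ D ℤ.* D ℤ.* (r ℤ.+ e ℤ.* T³) ℤ.- e ℤ.* (D ℤ.* D) ℤ.* T³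
    isolate = ℤ-solve
    factor : ∀ n e D T³ → n ℤ.* n ℤ.* T³ ℤ.- e ℤ.* (D ℤ.* D) ℤ.* T³ ≡ T³ ℤ.* (n ℤ.* n ℤ.- e ℤ.* (D ℤ.* D))
    factor = ℤ-solve
  t³∣r³d² : cube (suc tm) ∣ (cube ℤ.∣ r ∣ * (suc dm * suc dm))
  t³∣r³d² = subst (cube (suc tm) ∣_) (trans (ℤP.abs-* r³ (D ℤ.* D)) (cong (_* (suc dm * suc dm)) (abs-cube r)))
              (∣-∣-divides T³ _ (rearranged n r³ (+ e ℤ.* + e) D T³ cleared))
  d²≡t³ : suc dm * suc dm ≡ cube (suc tm)
  d²≡t³ = denominators n⊥d r⊥t d²∣n²t³ t³∣r³d²
  expand : ∀ n e D → (n ℤ.- e ℤ.* D) ℤ.* (n ℤ.+ e ℤ.* D) ℤ.* (D ℤ.* D) ≡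
                     n ℤ.* n ℤ.* (D ℤ.* D) ℤ.- D ℤ.* D ℤ.* (e ℤ.* e ℤ.* (D ℤ.* D))
  expand = ℤ-solve
  cancel : ∀ D² r³ c → D² ℤ.* (r³ ℤ.+ c) ℤ.- D² ℤ.* c ≡ r³ ℤ.* D²
  cancel = ℤ-solve

-- Outside 2e the numerators n - ed and n + ed share no prime when
-- gcd(n, d) = 1: such a prime divides their difference 2ed, hence d, hence n.
numerators-separated : ∀ e n dm → Coprime ℤ.∣ n ∣ (suc dm) →
  Separated (2 * e) ℤ.∣ n ℤ.- + e ℤ.* + suc dm ∣ ℤ.∣ n ℤ.+ + e ℤ.* + suc dm ∣
numerators-separated e n dm n⊥d p pr p∤2e p∣n-ed p∣n+ed with euclidsLemma (2 * e) (suc dm) pr p∣2ed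
  where
  D : ℤ
  D = + suc dm
  difference : ∀ n e D → n ℤ.+ e ℤ.* D ℤ.- (n ℤ.- e ℤ.* D) ≡ (+ 2 ℤ.* e) ℤ.* D
  difference = ℤ-solve
  p∣2ed : p ∣ 2 * e * suc dm
  p∣2ed = subst (p ∣_) (ℤP.abs-* (+ (2 * e)) D) (ℤ∣.∣⇒∣ᵤ (subst (+ p ℤ∣.∣_)
            (trans (difference n (+ e) D) (cong (ℤ._* D) (sym (ℤP.pos-* 2 e))))
            (ℤ∣.∣m∣n⇒∣m-n (ℤ∣.∣ᵤ⇒∣ {+ p} {n ℤ.+ + e ℤ.* D} p∣n+ed) (ℤ∣.∣ᵤ⇒∣ {+ p} {n ℤ.- + e ℤ.* D} p∣n-ed))))
... | inj₁ p∣2e = p∤2e p∣2e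
... | inj₂ p∣d = ¬prime[1] (subst Prime (n⊥d (p∣n , p∣d)) pr)
  where
  D : ℤ
  D = + suc dm
  recombine : ∀ n x → n ℤ.- x ℤ.+ x ≡ n
  recombine = ℤ-solve
  p∣n : p ∣ ℤ.∣ n ∣
  p∣n = ℤ∣.∣⇒∣ᵤ (subst (+ p ℤ∣.∣_) (recombine n (+ e ℤ.* D))
          (ℤ∣.∣m∣n⇒∣m+n (ℤ∣.∣ᵤ⇒∣ {+ p} {n ℤ.- + e ℤ.* D} p∣n-ed) (ℤ∣.∣n⇒∣m*n (+ e) (ℤ∣.∣ᵤ⇒∣ {+ p} {D} p∣d))))

sign-split : ∀ a → ∃[ ε ] ε ℤ.* ε ℤ.* ε ≡ ε × a ≡ ε ℤ.* + ℤ.∣ a ∣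
sign-split (+ k)    = + 1 , refl , sym (ℤP.*-identityˡ (+ k))
sign-split -[1+ k ] = ℤ.-1ℤ , refl , sym (ℤP.-1*i≡-i (+ suc k))

pos-cube-* : ∀ K W → + (K * cube W) ≡ + K ℤ.* (+ W ℤ.* + W ℤ.* + W)
pos-cube-* K W = trans (ℤP.pos-* K (cube W))
  (cong (+ K ℤ.*_) (trans (ℤP.pos-* (W * W) W) (cong (ℤ._* + W) (ℤP.pos-* W W))))

-- If |a| = K·W³ and d² = t³, then z = ±W·t satisfies K·z³ = a·d².
cube-witness : ∀ a K W dm tm → ℤ.∣ a ∣ ≡ K * cube W → suc dm * suc dm ≡ cube (suc tm) →
  ∃[ z ] + K ℤ.* (z ℤ.* z ℤ.* z) ≡ a ℤ.* (+ suc dm ℤ.* + suc dm)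
cube-witness a K W dm tm ∣a∣≡ d²≡t³ with sign-split a
... | ε , ε³≡ε , a≡ε∣a∣ = ε ℤ.* + W ℤ.* T , (begin
  + K ℤ.* ((ε ℤ.* + W ℤ.* T) ℤ.* (ε ℤ.* + W ℤ.* T) ℤ.* (ε ℤ.* + W ℤ.* T))
      ≡⟨ regroup ε (+ K) (+ W) T ⟩
  ε ℤ.* ε ℤ.* ε ℤ.* (+ K ℤ.* (+ W ℤ.* + W ℤ.* + W)) ℤ.* (T ℤ.* T ℤ.* T)
      ≡⟨ cong₂ (λ s X → s ℤ.* (+ K ℤ.* (+ W ℤ.* + W ℤ.* + W)) ℤ.* X) ε³≡ε (sym (cong +_ d²≡t³)) ⟩
  ε ℤ.* (+ K ℤ.* (+ W ℤ.* + W ℤ.* + W)) ℤ.* (D ℤ.* D)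
      ≡⟨ cong (λ X → ε ℤ.* X ℤ.* (D ℤ.* D)) (sym (trans (cong +_ ∣a∣≡) (pos-cube-* K W))) ⟩
  ε ℤ.* + ℤ.∣ a ∣ ℤ.* (D ℤ.* D)
      ≡⟨ cong (ℤ._* (D ℤ.* D)) (sym a≡ε∣a∣) ⟩
  a ℤ.* (D ℤ.* D) ∎)
  where
  open ≡-Reasoning
  D T : ℤ
  D = + suc dm
  T = + suc tm
  regroup : ∀ ε K W T → K ℤ.* ((ε ℤ.* W ℤ.* T) ℤ.* (ε ℤ.* W ℤ.* T) ℤ.* (ε ℤ.* W ℤ.* T)) ≡
                        ε ℤ.* ε ℤ.* ε ℤ.* (K ℤ.* (W ℤ.* W ℤ.* W)) ℤ.* (T ℤ.* T ℤ.* T)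
  regroup = ℤ-solve

Kᵘ : ℕ → ℚᵘ
Kᵘ K = mkℚᵘ (+ K) 0

cleared-point-equation : ∀ e n dm r tm .(n⊥d : Coprime ℤ.∣ n ∣ (suc dm)) .(r⊥t : Coprime ℤ.∣ r ∣ (suc tm)) →
  let y = mkℚ n dm n⊥d; x = mkℚ r tm r⊥t; D = + suc dm; T³ = + suc tm ℤ.* + suc tm ℤ.* + suc tm in
  y ℚ.* y ≡ x ℚ.* x ℚ.* x ℚ.+ ℕ→ℚ e ℚ.* ℕ→ℚ e →
  n ℤ.* n ℤ.* T³ ≡ D ℤ.* D ℤ.* (r ℤ.* r ℤ.* r ℤ.+ + e ℤ.* + e ℤ.* T³)
cleared-point-equation e n dm r tm n⊥d r⊥t on-curve with in-ℚᵘ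
  where
  y x : ℚ
  y = mkℚ n dm n⊥d
  x = mkℚ r tm r⊥t
  ê : toℚᵘ (ℕ→ℚ e) ≃ Kᵘ e
  ê = ℚP.toℚᵘ-fromℚᵘ (Kᵘ e)
  in-ℚᵘ : mkℚᵘ n dm ℚᵘ.* mkℚᵘ n dm ≃ mkℚᵘ r tm ℚᵘ.* mkℚᵘ r tm ℚᵘ.* mkℚᵘ r tm ℚᵘ.+ Kᵘ e ℚᵘ.* Kᵘ e
  in-ℚᵘ = ℚᵘP.≃-trans (ℚᵘP.≃-sym (ℚP.toℚᵘ-homo-* y y))
          (ℚᵘP.≃-trans (ℚP.toℚᵘ-cong on-curve)
          (ℚᵘP.≃-trans (ℚP.toℚᵘ-homo-+ (x ℚ.* x ℚ.* x) (ℕ→ℚ e ℚ.* ℕ→ℚ e))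
            (ℚᵘP.+-cong (ℚᵘP.≃-trans (ℚP.toℚᵘ-homo-* (x ℚ.* x) x) (ℚᵘP.*-cong (ℚP.toℚᵘ-homo-* x x) ℚᵘP.≃-refl))
                        (ℚᵘP.≃-trans (ℚP.toℚᵘ-homo-* (ℕ→ℚ e) (ℕ→ℚ e)) (ℚᵘP.*-cong ê ê)))))
... | *≡* cross = trans (tidyˡ (n ℤ.* n) T³) (trans cross (tidyʳ (r ℤ.* r ℤ.* r) (+ e ℤ.* + e) T³ (D ℤ.* D)))
  where
  D T³ : ℤ
  D = + suc dm
  T³ = + suc tm ℤ.* + suc tm ℤ.* + suc tm
  tidyˡ : ∀ N² T³ → N² ℤ.* T³ ≡ N² ℤ.* (T³ ℤ.* (+ 1 ℤ.* + 1))
  tidyˡ = ℤ-solve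
  tidyʳ : ∀ R³ E² T³ D² → (R³ ℤ.* (+ 1 ℤ.* + 1) ℤ.+ E² ℤ.* T³) ℤ.* D² ≡ D² ℤ.* (R³ ℤ.+ E² ℤ.* T³)
  tidyʳ = ℤ-solve

difference-as-fraction : ∀ e n dm .(n⊥d : Coprime ℤ.∣ n ∣ (suc dm)) →
  mkℚ n dm n⊥d ℚ.- ℕ→ℚ e ≡ fromℚᵘ (mkℚᵘ (n ℤ.- + e ℤ.* + suc dm) dm)
difference-as-fraction e n dm n⊥d = ℚP.toℚᵘ-injective (ℚᵘP.≃-trans in-ℚᵘ
  (ℚᵘP.≃-trans (*≡* {mkℚᵘ n dm ℚᵘ.+ (ℚᵘ.- Kᵘ e)} {a/d} (regroup n (+ e) D)) (ℚᵘP.≃-sym (ℚP.toℚᵘ-fromℚᵘ a/d))))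
  where
  y : ℚ
  y = mkℚ n dm n⊥d
  D : ℤ
  D = + suc dm
  a/d : ℚᵘ
  a/d = mkℚᵘ (n ℤ.- + e ℤ.* D) dm
  in-ℚᵘ : toℚᵘ (y ℚ.- ℕ→ℚ e) ≃ mkℚᵘ n dm ℚᵘ.+ (ℚᵘ.- Kᵘ e)
  in-ℚᵘ = ℚᵘP.≃-trans (ℚP.toℚᵘ-homo-+ y (ℚ.- ℕ→ℚ e))
            (ℚᵘP.+-cong (ℚᵘP.≃-refl {mkℚᵘ n dm})
              (ℚᵘP.≃-trans (ℚP.toℚᵘ-homo‿- (ℕ→ℚ e)) (ℚᵘP.-‿cong (ℚP.toℚᵘ-fromℚᵘ (Kᵘ e)))))
  regroup : ∀ n e D → (n ℤ.* + 1 ℤ.+ (ℤ.- e) ℤ.* D) ℤ.* D ≡ (n ℤ.- e ℤ.* D) ℤ.* (D ℤ.* + 1)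
  regroup = ℤ-solve

toℚᵘ-K*cube : ∀ K C → toℚᵘ (ℕ→ℚ K ℚ.* (fromℚᵘ C ℚ.* fromℚᵘ C ℚ.* fromℚᵘ C)) ≃ Kᵘ K ℚᵘ.* (C ℚᵘ.* C ℚᵘ.* C)
toℚᵘ-K*cube K C = ℚᵘP.≃-trans (ℚP.toℚᵘ-homo-* (ℕ→ℚ K) (c ℚ.* c ℚ.* c))
  (ℚᵘP.*-cong (ℚP.toℚᵘ-fromℚᵘ (Kᵘ K)) (ℚᵘP.≃-trans (ℚP.toℚᵘ-homo-* (c ℚ.* c) c)
    (ℚᵘP.*-cong (ℚᵘP.≃-trans (ℚP.toℚᵘ-homo-* c c) (ℚᵘP.*-cong c≃C c≃C)) c≃C)))
  where
  c : ℚ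
  c = fromℚᵘ C
  c≃C : toℚᵘ c ≃ C
  c≃C = ℚP.toℚᵘ-fromℚᵘ C

-- The cube class of a nonzero fraction a/d contains K as soon as K·z³ = a·d²
-- for some integer z: then a/d = K·(z/d)³.
cube-class-of-fraction : ∀ a z K dm → a ≢ 0ℤ → + K ℤ.* (z ℤ.* z ℤ.* z) ≡ a ℤ.* (+ suc dm ℤ.* + suc dm) →
  CubeClassEq (fromℚᵘ (mkℚᵘ a dm)) (ℕ→ℚ K)
cube-class-of-fraction a z K dm a≢0 Kz³≡ad² = c , c≢0 , a/d≡Kc³
  where
  D : ℤ
  D = + suc dm
  c : ℚ
  c = fromℚᵘ (mkℚᵘ z dm)
  cross : a ℤ.* (+ 1 ℤ.* (D ℤ.* D ℤ.* D)) ≡ + K ℤ.* (z ℤ.* z ℤ.* z) ℤ.* D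
  cross = begin
    a ℤ.* (+ 1 ℤ.* (D ℤ.* D ℤ.* D)) ≡⟨ regroup a D ⟩
    a ℤ.* (D ℤ.* D) ℤ.* D           ≡⟨ cong (ℤ._* D) (sym Kz³≡ad²) ⟩
    + K ℤ.* (z ℤ.* z ℤ.* z) ℤ.* D   ∎
    where
    open ≡-Reasoning
    regroup : ∀ a D → a ℤ.* (+ 1 ℤ.* (D ℤ.* D ℤ.* D)) ≡ a ℤ.* (D ℤ.* D) ℤ.* D
    regroup = ℤ-solve
  a/d≡Kc³ : fromℚᵘ (mkℚᵘ a dm) ≡ ℕ→ℚ K ℚ.* (c ℚ.* c ℚ.* c)
  a/d≡Kc³ = ℚP.toℚᵘ-injective (ℚᵘP.≃-trans (ℚP.toℚᵘ-fromℚᵘ (mkℚᵘ a dm))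
              (ℚᵘP.≃-trans (*≡* cross) (ℚᵘP.≃-sym (toℚᵘ-K*cube K (mkℚᵘ z dm)))))
  c≢0 : c ≢ ℚ.0ℚ
  c≢0 c≡0 with ℚᵘP.≃-trans (ℚᵘP.≃-sym (ℚP.toℚᵘ-fromℚᵘ (mkℚᵘ z dm))) (ℚP.toℚᵘ-cong c≡0)
  ... | *≡* z*1≡0 with trans (sym (ℤP.*-identityʳ z)) z*1≡0
  ...   | refl with ℤP.i*j≡0⇒i≡0∨j≡0 a (trans (sym Kz³≡ad²) (ℤP.*-zeroʳ (+ K)))
  ...     | inj₁ a≡0 = a≢0 a≡0

Representable : ℕ → ℚ → Set
Representable e q = Σ ℕ (λ A → Σ ℕ (λ B →
  1 ≤ A × 1 ≤ B × SquareFree A × SquareFree B × Coprime A B ×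
  A ∣ 2 * e × B ∣ 2 * e × CubeClassEq q (ℕ→ℚ (A * (B * B)))))

divisor-positive : ∀ {A M} → A ∣ M → 1 ≤ M → 1 ≤ A
divisor-positive {zero} 0∣M 1≤M with 0∣⇒≡0 0∣M
divisor-positive {zero} 0∣M () | refl
divisor-positive {suc _} _ _ = s≤s z≤n

representable-fraction : ∀ e a dm tm → 1 ≤ e → a ≢ 0ℤ → suc dm * suc dm ≡ cube (suc tm) →
  Decomposition (2 * e) ℤ.∣ a ∣ → Representable e (fromℚᵘ (mkℚᵘ a dm))
representable-fraction e a dm tm 1≤e a≢0 d²≡t³ (decomposition A B W sfA sfB A⊥B A∣2e B∣2e ∣a∣≡)
  with cube-witness a (A * (B * B)) W dm tm ∣a∣≡ d²≡t³
... | z , Kz³≡ad² =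
  A , B , divisor-positive A∣2e 1≤2e , divisor-positive B∣2e 1≤2e , sfA , sfB , A⊥B , A∣2e , B∣2e ,
  cube-class-of-fraction a z (A * (B * B)) dm a≢0 Kz³≡ad²
  where
  1≤2e : 1 ≤ 2 * e
  1≤2e = ℕP.≤-trans (s≤s z≤n) (ℕP.*-monoʳ-≤ 2 1≤e)

-- The point (0, e): α₋ = 1/(2e) = M²/M³ for M = 2e, and M² decomposes over M
-- because M²·M is a cube.
representable-inv2e : ∀ k → Representable (suc k) (inv2e (suc k))
representable-inv2e k = subst (Representable (suc k)) (sym 1/M≡M²/M³)
  (representable-fraction (suc k) (+ (M * M)) (pred (M * M * M)) (pred (M * M)) (s≤s z≤n) (λ ()) (sixth-power M)
    (decompose (M * M) M M refl (λ p _ p∤M _ p∣M → p∤M p∣M)))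
  where
  M : ℕ
  M = 2 * suc k
  sixth-power : ∀ M → M * M * M * (M * M * M) ≡ M * M * (M * M) * (M * M)
  sixth-power = solve-∀
  1/M≡M²/M³ : inv2e (suc k) ≡ fromℚᵘ (mkℚᵘ (+ (M * M)) (pred (M * M * M)))
  1/M≡M²/M³ = ℚP.fromℚᵘ-cong {mkℚᵘ (+ 1) (pred M)} {mkℚᵘ (+ (M * M)) (pred (M * M * M))}
                (*≡* (trans (ℤP.*-identityˡ (+ (M * M * M))) (ℤP.pos-* (M * M) M)))

representable-difference : ∀ e → 1 ≤ e → ∀ x y → y ℚ.* y ≡ x ℚ.* x ℚ.* x ℚ.+ ℕ→ℚ e ℚ.* ℕ→ℚ e →
  y ≢ ℕ→ℚ e → Representable e (y ℚ.- ℕ→ℚ e)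
representable-difference e 1≤e (mkℚ r tm r⊥t) (mkℚ n dm n⊥d) on-curve y≢e =
  subst (Representable e) (sym (difference-as-fraction e n dm n⊥d))
    (representable-fraction e a dm tm 1≤e a≢0 d²≡t³
      (decompose ℤ.∣ a ∣ ℤ.∣ b ∣ ℤ.∣ r ∣ product≡∣r∣³ (numerators-separated e n dm (recompute n⊥d))))
  where
  D a b : ℤ
  D = + suc dm
  a = n ℤ.- + e ℤ.* D
  b = n ℤ.+ + e ℤ.* D
  lowest-terms : suc dm * suc dm ≡ cube (suc tm) × a ℤ.* b ≡ r ℤ.* r ℤ.* r
  lowest-terms = lowest-terms-point e n dm r tm (recompute n⊥d) (recompute r⊥t)
                   (cleared-point-equation e n dm r tm n⊥d r⊥t on-curve)
  d²≡t³ : suc dm * suc dm ≡ cube (suc tm)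
  d²≡t³ = proj₁ lowest-terms
  product≡r³ : a ℤ.* b ≡ r ℤ.* r ℤ.* r
  product≡r³ = proj₂ lowest-terms
  product≡∣r∣³ : ℤ.∣ a ∣ * ℤ.∣ b ∣ ≡ cube ℤ.∣ r ∣
  product≡∣r∣³ = trans (sym (ℤP.abs-* a b)) (trans (cong ℤ.∣_∣ product≡r³) (abs-cube r))
  recombine : ∀ n x → n ℤ.- x ℤ.+ x ≡ n
  recombine = ℤ-solve
  a≢0 : a ≢ 0ℤ
  a≢0 a≡0 = y≢e (ℚP.toℚᵘ-injective (ℚᵘP.≃-trans (*≡* {mkℚᵘ n dm} {Kᵘ e} n≡ed)
                                                   (ℚᵘP.≃-sym (ℚP.toℚᵘ-fromℚᵘ (Kᵘ e)))))
    where
    open ≡-Reasoning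
    n≡ed : n ℤ.* + 1 ≡ + e ℤ.* D
    n≡ed = begin
      n ℤ.* + 1          ≡⟨ ℤP.*-identityʳ n ⟩
      n                  ≡⟨ sym (recombine n (+ e ℤ.* D)) ⟩
      a ℤ.+ + e ℤ.* D    ≡⟨ cong (ℤ._+ + e ℤ.* D) a≡0 ⟩
      0ℤ ℤ.+ + e ℤ.* D   ≡⟨ ℤP.+-identityˡ (+ e ℤ.* D) ⟩
      + e ℤ.* D          ∎

-- Lemma 12.1: for every rational point P, α₋(P) is represented by A·B² with
-- A, B coprime, square-free, positive and dividing 2e.
lemma12p1 : (e : ℕ) → 2 ≤ e → CubeFree e → (P : Point e) →
  Σ ℕ (λ A → Σ ℕ (λ B →
  1 ≤ A × 1 ≤ B × SquareFree A × SquareFree B × Coprime A B ×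
  A ∣ 2 * e × B ∣ 2 * e ×
  CubeClassEq (α₋ e P) (ℕ→ℚ (A * (B * B)))))
lemma12p1 zero () _ _
lemma12p1 (suc k) _ _ P∞ =
  1 , 1 , s≤s z≤n , s≤s z≤n , squareFree-1 , squareFree-1 , 1-coprimeTo 1 , 1∣ _ , 1∣ _ ,
  ℚ.1ℚ , (λ ()) , refl
lemma12p1 (suc k) _ _ (aff x y on-curve) with y ℚP.≟ ℕ→ℚ (suc k)
... | yes _   = representable-inv2e k
... | no y≢e  = representable-difference (suc k) (s≤s z≤n) x y on-curve y≢e
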